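{- Let $b\in\mathbb{Z}[i]$ be nonzero and fourth-power-free, $b=i^{s_b}(1+i)^{t_b}\mathfrak{p}_1^{r_1}\cdots\mathfrak{p}_M^{r_M}\mathfrak{q}_1^2\cdots\mathfrak{q}_N^2$ with $s_b,t_b\in\{0,1,2,3\}$, $r_i\in\{1,3\}$, and $\mathfrak{p}_i,\mathfrak{q}_j$ distinct primary primes. Write $s_b=s_{b,0}+2s_{b,1}$ and $t_b=t_{b,0}+2t_{b,1}$ with $s_{b,0},s_{b,1},t_{b,0},t_{b,1}\in\{0,1\}$. Then $i^{s_{b,0}}(1+i)^{t_{b,0}}\mathfrak{p}_1\cdots\mathfrak{p}_M\in S^{(\varphi)}(E_b/\mathbb{Q}(i))$.
   Context: A Gaussian integer is primary if it is $\equiv1\pmod{(1+i)^3}$. $E_b:y^2=x^3+bx$ over $\mathbb{Q}(i)$ with the $2$-isogeny $\varphi:E_b\to E_{ -4b}$, $\varphi(x,y)=(y^2/x^2,\,y(b-x^2)/x^2)$. For $d\mid 2b$ let $C_d\subset\mathbb{P}^3$ be the curve $dX_2^2=d^2X_0^2-4bX_3^2$, $X_1^2=X_0X_3$ (affine part $dw^2=d^2-4bz^4$). The $\varphi$-Selmer group $S^{(\varphi)}(E_b/\mathbb{Q}(i))$ is identified with the set of classes in $\mathbb{Q}(i)^*/(\mathbb{Q}(i)^*)^2$ of elements $d\mid 2b$ with $C_d(\mathbb{Q}(i)_v)\ne\emptyset$ for every place $v\mid 2b$ ($\mathbb{Q}(i)_v$ the completion); membership of $d$ means membership of its class. -}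

module Defs where

open import Data.Nat as ℕ using (ℕ; zero; suc)
open import Data.Integer as ℤ using (ℤ; +_)
open import Data.Fin using (Fin)
import Data.Fin as Fin
open import Data.Product using (Σ; ∃; ∃₂; _×_; _,_)
open import Data.List using (List; []; _∷_; foldr)
open import Relation.Binary.PropositionalEquality using (_≡_; _≢_)
open import Relation.Nullary using (¬_)
open import Data.Sum using (_⊎_)

record ℤ[i] : Set where
  constructor gi
  field
    re : ℤ
    im : ℤ

open ℤ[i] public

infixl 6 _+ᵍ_ _-ᵍ_
infixl 7 _*ᵍ_
infixr 8 _^ᵍ_

_+ᵍ_ : ℤ[i] → ℤ[i] → ℤ[i]
gi a b +ᵍ gi c d = gi (a ℤ.+ c) (b ℤ.+ d)

-ᵍ_ : ℤ[i] → ℤ[i]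
-ᵍ gi a b = gi (ℤ.- a) (ℤ.- b)

_-ᵍ_ : ℤ[i] → ℤ[i] → ℤ[i]
x -ᵍ y = x +ᵍ (-ᵍ y)

_*ᵍ_ : ℤ[i] → ℤ[i] → ℤ[i]
gi a b *ᵍ gi c d = gi (a ℤ.* c ℤ.- b ℤ.* d) (a ℤ.* d ℤ.+ b ℤ.* c)

0ᵍ 1ᵍ iᵍ 2ᵍ 4ᵍ 1+iᵍ : ℤ[i]
0ᵍ = gi (+ 0) (+ 0)
1ᵍ = gi (+ 1) (+ 0)
iᵍ = gi (+ 0) (+ 1)
2ᵍ = gi (+ 2) (+ 0)
4ᵍ = gi (+ 4) (+ 0)
1+iᵍ = gi (+ 1) (+ 1)

_^ᵍ_ : ℤ[i] → ℕ → ℤ[i]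
x ^ᵍ zero = 1ᵍ
x ^ᵍ suc n = x *ᵍ (x ^ᵍ n)

prodᵍ : List ℤ[i] → ℤ[i]
prodᵍ = foldr _*ᵍ_ 1ᵍ

infix 4 _∣ᵍ_
_∣ᵍ_ : ℤ[i] → ℤ[i] → Set
a ∣ᵍ b = ∃ λ c → b ≡ a *ᵍ c

IsUnit : ℤ[i] → Set
IsUnit u = u ∣ᵍ 1ᵍ

IsPrime : ℤ[i] → Set
IsPrime p = p ≢ 0ᵍ × ¬ IsUnit p × (∀ a b → p ∣ᵍ a *ᵍ b → (p ∣ᵍ a) ⊎ (p ∣ᵍ b))

Primary : ℤ[i] → Set
Primary a = (1+iᵍ ^ᵍ 3) ∣ᵍ (a -ᵍ 1ᵍ)

FourthPowerFree : ℤ[i] → Set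
FourthPowerFree b = ∀ x → (x ^ᵍ 4) ∣ᵍ b → IsUnit x

-- d and d' (nonzero) define the same class in ℚ(i)* / (ℚ(i)*)²:
-- d/d' = (v/u)² with u, v ∈ ℤ[i] nonzero.
SameSquareClass : ℤ[i] → ℤ[i] → Set
SameSquareClass d d' =
  ∃₂ λ u v → u ≢ 0ᵍ × v ≢ 0ᵍ × (d *ᵍ (u ^ᵍ 2) ≡ d' *ᵍ (v ^ᵍ 2))

-- The completion at a finite place π (π a prime of ℤ[i]).
-- The ring of integers O_π = lim← ℤ[i]/π^n is represented by coherent
-- sequences: a n represents the element modulo π^n.

Coherent : ℤ[i] → (ℕ → ℤ[i]) → Set
Coherent π a = ∀ n → (π ^ᵍ n) ∣ᵍ (a (suc n) -ᵍ a n)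

-- A point of C_d ⊂ ℙ³ over ℚ(i)_π.  Since ℙ³(K_π) = ℙ³(O_π), a point is a
-- primitive quadruple (X₀,X₁,X₂,X₃) ∈ O_π⁴ (some coordinate a unit,
-- i.e. not ≡ 0 mod π) satisfying
--   d X₂² = d² X₀² − 4 b X₃²,   X₁² = X₀ X₃
-- in O_π (i.e. modulo π^n for every n).
record LocalPoint (π d b : ℤ[i]) : Set where
  field
    X         : Fin 4 → ℕ → ℤ[i]
    coherent  : ∀ j → Coherent π (X j)
    primitiv  : ∃ λ j → ¬ (π ∣ᵍ X j 1)
    eqn₁      : ∀ n → (π ^ᵍ n) ∣ᵍ
                  (d *ᵍ (X (Fin.suc (Fin.suc Fin.zero)) n ^ᵍ 2)
                   -ᵍ ((d ^ᵍ 2) *ᵍ (X Fin.zero n ^ᵍ 2)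
                       -ᵍ 4ᵍ *ᵍ b *ᵍ (X (Fin.suc (Fin.suc (Fin.suc Fin.zero))) n ^ᵍ 2)))
    eqn₂      : ∀ n → (π ^ᵍ n) ∣ᵍ
                  ((X (Fin.suc Fin.zero) n ^ᵍ 2)
                   -ᵍ X Fin.zero n *ᵍ X (Fin.suc (Fin.suc (Fin.suc Fin.zero))) n)

-- C_d(ℚ(i)_v) ≠ ∅ for every place v ∣ 2b (places ↔ primes π ∣ 2b)
LocallySoluble : ℤ[i] → ℤ[i] → Set
LocallySoluble d b = ∀ π → IsPrime π → π ∣ᵍ (2ᵍ *ᵍ b) → LocalPoint π d b

-- x ∈ S^(φ)(E_b/ℚ(i)): the class of x is the class of some d ∣ 2b
-- with C_d locally soluble at every v ∣ 2b.
InSelmer : ℤ[i] → ℤ[i] → Set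
InSelmer b x = ∃ λ d → d ∣ᵍ (2ᵍ *ᵍ b) × SameSquareClass x d × LocallySoluble d b

{-# OPTIONS --safe #-}

-- With m = i^{s₁} (1+i)^{t₁} ∏_{r_k = 3} 𝔭_k ∏ 𝔮_j the hypothesis says b = d m², where d is the
-- element in question. Hence d ∣ 2b, and C_d has the global point (X₀ : X₁ : X₂ : X₃) = (0 : 0 : 2im : 1),
-- because d (2im)² = −4b. A global point with X₃ = 1 is a primitive local point at every prime,
-- so d lies in the Selmer group: its class is that of b, the image of the 2-torsion point (0,0)
-- of E_{−4b}.

module Submission where

open import Defs
open import Level using (0ℓ)
open import Data.Nat using (ℕ; zero; suc; _+_; _*_; _≤_; ⌊_/2⌋)
open import Data.Integer using (+_)
import Data.Integer as ℤ
import Data.Integer.Properties as ℤ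
import Data.Integer.Tactic.RingSolver as ℤ
open import Data.Fin using (Fin)
open import Data.Fin.Patterns using (0F; 1F; 2F; 3F)
open import Data.Maybe using (just; nothing)
open import Data.Product using (_×_; _,_; proj₁; proj₂)
open import Data.Sum using (_⊎_; inj₁; inj₂)
open import Data.List using (List; []; _∷_; map; _++_)
open import Data.List.Relation.Unary.All as All using (All)
open import Data.List.Relation.Unary.Unique.Propositional using (Unique)
open import Relation.Nullary using (¬_)
open import Relation.Binary.PropositionalEquality
open import Algebra.Bundles using (CommutativeRing)
open import Algebra.Structures using (IsCommutativeRing)
open import Tactic.RingSolver using (solve-∀)
open import Tactic.RingSolver.Core.AlmostCommutativeRing
  using (AlmostCommutativeRing; fromCommutativeRing)

+ᵍ-assoc : ∀ x y z → (x +ᵍ y) +ᵍ z ≡ x +ᵍ (y +ᵍ z)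
+ᵍ-assoc (gi a b) (gi c d) (gi e f) = cong₂ gi (ℤ.+-assoc a c e) (ℤ.+-assoc b d f)

+ᵍ-comm : ∀ x y → x +ᵍ y ≡ y +ᵍ x
+ᵍ-comm (gi a b) (gi c d) = cong₂ gi (ℤ.+-comm a c) (ℤ.+-comm b d)

+ᵍ-identityˡ : ∀ x → 0ᵍ +ᵍ x ≡ x
+ᵍ-identityˡ (gi a b) = cong₂ gi (ℤ.+-identityˡ a) (ℤ.+-identityˡ b)

+ᵍ-identityʳ : ∀ x → x +ᵍ 0ᵍ ≡ x
+ᵍ-identityʳ (gi a b) = cong₂ gi (ℤ.+-identityʳ a) (ℤ.+-identityʳ b)

+ᵍ-inverseˡ : ∀ x → -ᵍ x +ᵍ x ≡ 0ᵍ
+ᵍ-inverseˡ (gi a b) = cong₂ gi (ℤ.+-inverseˡ a) (ℤ.+-inverseˡ b)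

+ᵍ-inverseʳ : ∀ x → x +ᵍ -ᵍ x ≡ 0ᵍ
+ᵍ-inverseʳ (gi a b) = cong₂ gi (ℤ.+-inverseʳ a) (ℤ.+-inverseʳ b)

*ᵍ-assoc : ∀ x y z → (x *ᵍ y) *ᵍ z ≡ x *ᵍ (y *ᵍ z)
*ᵍ-assoc (gi a b) (gi c d) (gi e f) = cong₂ gi re-assoc im-assoc
  where
  re-assoc : (a ℤ.* c ℤ.- b ℤ.* d) ℤ.* e ℤ.- (a ℤ.* d ℤ.+ b ℤ.* c) ℤ.* f
           ≡ a ℤ.* (c ℤ.* e ℤ.- d ℤ.* f) ℤ.- b ℤ.* (c ℤ.* f ℤ.+ d ℤ.* e)
  re-assoc = ℤ.solve (a ∷ b ∷ c ∷ d ∷ e ∷ f ∷ [])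
  im-assoc : (a ℤ.* c ℤ.- b ℤ.* d) ℤ.* f ℤ.+ (a ℤ.* d ℤ.+ b ℤ.* c) ℤ.* e
           ≡ a ℤ.* (c ℤ.* f ℤ.+ d ℤ.* e) ℤ.+ b ℤ.* (c ℤ.* e ℤ.- d ℤ.* f)
  im-assoc = ℤ.solve (a ∷ b ∷ c ∷ d ∷ e ∷ f ∷ [])

*ᵍ-comm : ∀ x y → x *ᵍ y ≡ y *ᵍ x
*ᵍ-comm (gi a b) (gi c d) = cong₂ gi (ℤ.solve (a ∷ b ∷ c ∷ d ∷ [])) (ℤ.solve (a ∷ b ∷ c ∷ d ∷ []))

*ᵍ-identityˡ : ∀ x → 1ᵍ *ᵍ x ≡ x
*ᵍ-identityˡ (gi a b) = cong₂ gi (ℤ.solve (a ∷ b ∷ [])) (ℤ.solve (a ∷ b ∷ []))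

*ᵍ-identityʳ : ∀ x → x *ᵍ 1ᵍ ≡ x
*ᵍ-identityʳ (gi a b) = cong₂ gi (ℤ.solve (a ∷ b ∷ [])) (ℤ.solve (a ∷ b ∷ []))

*ᵍ-distribˡ-+ᵍ : ∀ x y z → x *ᵍ (y +ᵍ z) ≡ x *ᵍ y +ᵍ x *ᵍ z
*ᵍ-distribˡ-+ᵍ (gi a b) (gi c d) (gi e f) = cong₂ gi re-distrib im-distrib
  where
  re-distrib : a ℤ.* (c ℤ.+ e) ℤ.- b ℤ.* (d ℤ.+ f) ≡ (a ℤ.* c ℤ.- b ℤ.* d) ℤ.+ (a ℤ.* e ℤ.- b ℤ.* f)
  re-distrib = ℤ.solve (a ∷ b ∷ c ∷ d ∷ e ∷ f ∷ [])
  im-distrib : a ℤ.* (d ℤ.+ f) ℤ.+ b ℤ.* (c ℤ.+ e) ≡ (a ℤ.* d ℤ.+ b ℤ.* c) ℤ.+ (a ℤ.* f ℤ.+ b ℤ.* e)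
  im-distrib = ℤ.solve (a ∷ b ∷ c ∷ d ∷ e ∷ f ∷ [])

*ᵍ-distribʳ-+ᵍ : ∀ x y z → (y +ᵍ z) *ᵍ x ≡ y *ᵍ x +ᵍ z *ᵍ x
*ᵍ-distribʳ-+ᵍ x y z = begin
  (y +ᵍ z) *ᵍ x      ≡⟨ *ᵍ-comm (y +ᵍ z) x ⟩
  x *ᵍ (y +ᵍ z)      ≡⟨ *ᵍ-distribˡ-+ᵍ x y z ⟩
  x *ᵍ y +ᵍ x *ᵍ z   ≡⟨ cong₂ _+ᵍ_ (*ᵍ-comm x y) (*ᵍ-comm x z) ⟩
  y *ᵍ x +ᵍ z *ᵍ x   ∎
  where open ≡-Reasoning

ℤ[i]-isCommutativeRing : IsCommutativeRing _≡_ _+ᵍ_ _*ᵍ_ -ᵍ_ 0ᵍ 1ᵍ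
ℤ[i]-isCommutativeRing = record
  { isRing = record
    { +-isAbelianGroup = record
      { isGroup = record
        { isMonoid = record
          { isSemigroup = record
            { isMagma = record { isEquivalence = isEquivalence ; ∙-cong = cong₂ _+ᵍ_ }
            ; assoc = +ᵍ-assoc }
          ; identity = +ᵍ-identityˡ , +ᵍ-identityʳ }
        ; inverse = +ᵍ-inverseˡ , +ᵍ-inverseʳ
        ; ⁻¹-cong = cong (-ᵍ_) }
      ; comm = +ᵍ-comm }
    ; *-cong = cong₂ _*ᵍ_
    ; *-assoc = *ᵍ-assoc
    ; *-identity = *ᵍ-identityˡ , *ᵍ-identityʳ
    ; distrib = *ᵍ-distribˡ-+ᵍ , *ᵍ-distribʳ-+ᵍ
    }
  ; *-comm = *ᵍ-comm }

ℤ[i]-commutativeRing : CommutativeRing 0ℓ 0ℓ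
ℤ[i]-commutativeRing = record { isCommutativeRing = ℤ[i]-isCommutativeRing }

private
  ℤ[i]-ring : AlmostCommutativeRing 0ℓ 0ℓ
  ℤ[i]-ring = fromCommutativeRing ℤ[i]-commutativeRing λ where
    (gi (+ 0) (+ 0)) → just refl
    _                → nothing

open import Algebra.Properties.CommutativeSemigroup
  (CommutativeRing.*-commutativeSemigroup ℤ[i]-commutativeRing) using (interchange; x∙yz≈y∙xz)

^ᵍ-zeroˡ : ∀ n → 1ᵍ ^ᵍ n ≡ 1ᵍ
^ᵍ-zeroˡ zero    = refl
^ᵍ-zeroˡ (suc n) = trans (*ᵍ-identityˡ (1ᵍ ^ᵍ n)) (^ᵍ-zeroˡ n)

^ᵍ-distribˡ-+-*ᵍ : ∀ x m n → x ^ᵍ (m + n) ≡ x ^ᵍ m *ᵍ x ^ᵍ n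
^ᵍ-distribˡ-+-*ᵍ x zero    n = sym (*ᵍ-identityˡ (x ^ᵍ n))
^ᵍ-distribˡ-+-*ᵍ x (suc m) n = begin
  x *ᵍ x ^ᵍ (m + n)          ≡⟨ cong (x *ᵍ_) (^ᵍ-distribˡ-+-*ᵍ x m n) ⟩
  x *ᵍ (x ^ᵍ m *ᵍ x ^ᵍ n)    ≡⟨ *ᵍ-assoc x (x ^ᵍ m) (x ^ᵍ n) ⟨
  x *ᵍ x ^ᵍ m *ᵍ x ^ᵍ n      ∎
  where open ≡-Reasoning

^ᵍ-*-assoc : ∀ x m n → (x ^ᵍ n) ^ᵍ m ≡ x ^ᵍ (m * n)
^ᵍ-*-assoc x zero    n = refl
^ᵍ-*-assoc x (suc m) n = begin
  x ^ᵍ n *ᵍ (x ^ᵍ n) ^ᵍ m     ≡⟨ cong (x ^ᵍ n *ᵍ_) (^ᵍ-*-assoc x m n) ⟩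
  x ^ᵍ n *ᵍ x ^ᵍ (m * n)      ≡⟨ ^ᵍ-distribˡ-+-*ᵍ x n (m * n) ⟨
  x ^ᵍ (n + m * n)           ∎
  where open ≡-Reasoning

^ᵍ-distribʳ-*ᵍ : ∀ x y n → (x *ᵍ y) ^ᵍ n ≡ x ^ᵍ n *ᵍ y ^ᵍ n
^ᵍ-distribʳ-*ᵍ x y zero    = refl
^ᵍ-distribʳ-*ᵍ x y (suc n) = begin
  x *ᵍ y *ᵍ (x *ᵍ y) ^ᵍ n           ≡⟨ cong (x *ᵍ y *ᵍ_) (^ᵍ-distribʳ-*ᵍ x y n) ⟩
  x *ᵍ y *ᵍ (x ^ᵍ n *ᵍ y ^ᵍ n)      ≡⟨ interchange x y (x ^ᵍ n) (y ^ᵍ n) ⟩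
  x *ᵍ x ^ᵍ n *ᵍ (y *ᵍ y ^ᵍ n)      ∎
  where open ≡-Reasoning

*ᵍ-^ᵍ-interchange : ∀ x a y b n → x *ᵍ a ^ᵍ n *ᵍ (y *ᵍ b ^ᵍ n) ≡ x *ᵍ y *ᵍ (a *ᵍ b) ^ᵍ n
*ᵍ-^ᵍ-interchange x a y b n = begin
  x *ᵍ a ^ᵍ n *ᵍ (y *ᵍ b ^ᵍ n)   ≡⟨ interchange x (a ^ᵍ n) y (b ^ᵍ n) ⟩
  x *ᵍ y *ᵍ (a ^ᵍ n *ᵍ b ^ᵍ n)   ≡⟨ cong (x *ᵍ y *ᵍ_) (^ᵍ-distribʳ-*ᵍ a b n) ⟨
  x *ᵍ y *ᵍ (a *ᵍ b) ^ᵍ n        ∎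
  where open ≡-Reasoning

^ᵍ-+2* : ∀ x s t → x ^ᵍ (s + 2 * t) ≡ x ^ᵍ s *ᵍ (x ^ᵍ t) ^ᵍ 2
^ᵍ-+2* x s t = trans (^ᵍ-distribˡ-+-*ᵍ x s (2 * t)) (cong (x ^ᵍ s *ᵍ_) (sym (^ᵍ-*-assoc x 2 t)))

prodᵍ-map-^ᵍ : ∀ n xs → prodᵍ (map (_^ᵍ n) xs) ≡ prodᵍ xs ^ᵍ n
prodᵍ-map-^ᵍ n []       = sym (^ᵍ-zeroˡ n)
prodᵍ-map-^ᵍ n (x ∷ xs) = begin
  x ^ᵍ n *ᵍ prodᵍ (map (_^ᵍ n) xs)  ≡⟨ cong (x ^ᵍ n *ᵍ_) (prodᵍ-map-^ᵍ n xs) ⟩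
  x ^ᵍ n *ᵍ prodᵍ xs ^ᵍ n            ≡⟨ ^ᵍ-distribʳ-*ᵍ x (prodᵍ xs) n ⟨
  (x *ᵍ prodᵍ xs) ^ᵍ n               ∎
  where open ≡-Reasoning

prodᵍ-odd-powers : ∀ ps → All (λ pr → proj₂ pr ≡ 1 + 2 * ⌊ proj₂ pr /2⌋) ps →
  prodᵍ (map (λ pr → proj₁ pr ^ᵍ proj₂ pr) ps)
    ≡ prodᵍ (map proj₁ ps) *ᵍ prodᵍ (map (λ pr → proj₁ pr ^ᵍ ⌊ proj₂ pr /2⌋) ps) ^ᵍ 2
prodᵍ-odd-powers []             All.[]             = refl
prodᵍ-odd-powers ((p , r) ∷ ps) (r-odd All.∷ odd) = begin
  p ^ᵍ r *ᵍ prodᵍ (map (λ pr → proj₁ pr ^ᵍ proj₂ pr) ps)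
    ≡⟨ cong₂ _*ᵍ_ (trans (cong (p ^ᵍ_) r-odd) (cong (p *ᵍ_) (sym (^ᵍ-*-assoc p 2 k))))
                  (prodᵍ-odd-powers ps odd) ⟩
  p *ᵍ (p ^ᵍ k) ^ᵍ 2 *ᵍ (P *ᵍ H ^ᵍ 2)
    ≡⟨ *ᵍ-^ᵍ-interchange p (p ^ᵍ k) P H 2 ⟩
  p *ᵍ P *ᵍ (p ^ᵍ k *ᵍ H) ^ᵍ 2
    ∎
  where
  open ≡-Reasoning
  k : ℕ
  k = ⌊ r /2⌋
  P H : ℤ[i]
  P = prodᵍ (map proj₁ ps)
  H = prodᵍ (map (λ pr → proj₁ pr ^ᵍ ⌊ proj₂ pr /2⌋) ps)

≡⇒∣ᵍ-difference : ∀ a {x y} → x ≡ y → a ∣ᵍ x -ᵍ y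
≡⇒∣ᵍ-difference a {x} refl = 0ᵍ , trans (+ᵍ-inverseʳ x) (sym (zeroʳ a))
  where open CommutativeRing ℤ[i]-commutativeRing using (zeroʳ)

point⇒LocalPoint : ∀ {π d b} (X : Fin 4 → ℤ[i]) (j : Fin 4) → ¬ π ∣ᵍ X j →
  d *ᵍ X 2F ^ᵍ 2 ≡ d ^ᵍ 2 *ᵍ X 0F ^ᵍ 2 -ᵍ 4ᵍ *ᵍ b *ᵍ X 3F ^ᵍ 2 →
  X 1F ^ᵍ 2 ≡ X 0F *ᵍ X 3F →
  LocalPoint π d b
point⇒LocalPoint {π} X j π∤Xj eqn₁ eqn₂ = record
  { X        = λ k _ → X k
  ; coherent = λ k n → ≡⇒∣ᵍ-difference (π ^ᵍ n) {X k} refl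
  ; primitiv = j , π∤Xj
  ; eqn₁     = λ n → ≡⇒∣ᵍ-difference (π ^ᵍ n) eqn₁
  ; eqn₂     = λ n → ≡⇒∣ᵍ-difference (π ^ᵍ n) eqn₂
  }

LocallySoluble-square-multiple : ∀ d m → LocallySoluble d (d *ᵍ m ^ᵍ 2)
LocallySoluble-square-multiple d m π (_ , π-nonunit , _) _ =
  point⇒LocalPoint X 3F π-nonunit (on-C d m) refl
  where
  X : Fin 4 → ℤ[i]
  X 0F = 0ᵍ
  X 1F = 0ᵍ
  X 2F = 2ᵍ *ᵍ iᵍ *ᵍ m
  X 3F = 1ᵍ
  -- Squares are written unfolded, x ^ᵍ 2 = x *ᵍ (x *ᵍ 1ᵍ), the form the ring solver can read.
  on-C : ∀ d m → d *ᵍ (2ᵍ *ᵍ iᵍ *ᵍ m *ᵍ (2ᵍ *ᵍ iᵍ *ᵍ m *ᵍ 1ᵍ))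
                 ≡ d *ᵍ (d *ᵍ 1ᵍ) *ᵍ 0ᵍ ^ᵍ 2 -ᵍ 4ᵍ *ᵍ (d *ᵍ (m *ᵍ (m *ᵍ 1ᵍ))) *ᵍ 1ᵍ ^ᵍ 2
  on-C = solve-∀ ℤ[i]-ring

SameSquareClass-refl : ∀ d → SameSquareClass d d
SameSquareClass-refl d = 1ᵍ , 1ᵍ , (λ ()) , (λ ()) , refl

InSelmer-square-multiple : ∀ d m → InSelmer (d *ᵍ m ^ᵍ 2) d
InSelmer-square-multiple d m =
  d , (2ᵍ *ᵍ m ^ᵍ 2 , x∙yz≈y∙xz 2ᵍ d (m ^ᵍ 2)) , SameSquareClass-refl d , LocallySoluble-square-multiple d m

odd-part-*ᵍ-square : ∀ s₀ s₁ t₀ t₁ ps qs → All (λ pr → proj₂ pr ≡ 1 + 2 * ⌊ proj₂ pr /2⌋) ps →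
  iᵍ ^ᵍ (s₀ + 2 * s₁) *ᵍ 1+iᵍ ^ᵍ (t₀ + 2 * t₁)
    *ᵍ prodᵍ (map (λ pr → proj₁ pr ^ᵍ proj₂ pr) ps) *ᵍ prodᵍ (map (_^ᵍ 2) qs)
  ≡ iᵍ ^ᵍ s₀ *ᵍ 1+iᵍ ^ᵍ t₀ *ᵍ prodᵍ (map proj₁ ps)
    *ᵍ (iᵍ ^ᵍ s₁ *ᵍ 1+iᵍ ^ᵍ t₁ *ᵍ prodᵍ (map (λ pr → proj₁ pr ^ᵍ ⌊ proj₂ pr /2⌋) ps) *ᵍ prodᵍ qs) ^ᵍ 2
odd-part-*ᵍ-square s₀ s₁ t₀ t₁ ps qs odd-exponents = begin
  iᵍ ^ᵍ (s₀ + 2 * s₁) *ᵍ 1+iᵍ ^ᵍ (t₀ + 2 * t₁)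
    *ᵍ prodᵍ (map (λ pr → proj₁ pr ^ᵍ proj₂ pr) ps) *ᵍ prodᵍ (map (_^ᵍ 2) qs)
    ≡⟨ cong₂ _*ᵍ_ (cong₂ _*ᵍ_ (cong₂ _*ᵍ_ (^ᵍ-+2* iᵍ s₀ s₁) (^ᵍ-+2* 1+iᵍ t₀ t₁))
                              (prodᵍ-odd-powers ps odd-exponents))
                  (prodᵍ-map-^ᵍ 2 qs) ⟩
  A *ᵍ B ^ᵍ 2 *ᵍ (C *ᵍ D ^ᵍ 2) *ᵍ (P *ᵍ H ^ᵍ 2) *ᵍ G ^ᵍ 2
    ≡⟨ cong (λ x → x *ᵍ (P *ᵍ H ^ᵍ 2) *ᵍ G ^ᵍ 2) (*ᵍ-^ᵍ-interchange A B C D 2) ⟩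
  A *ᵍ C *ᵍ (B *ᵍ D) ^ᵍ 2 *ᵍ (P *ᵍ H ^ᵍ 2) *ᵍ G ^ᵍ 2
    ≡⟨ cong (_*ᵍ G ^ᵍ 2) (*ᵍ-^ᵍ-interchange (A *ᵍ C) (B *ᵍ D) P H 2) ⟩
  A *ᵍ C *ᵍ P *ᵍ (B *ᵍ D *ᵍ H) ^ᵍ 2 *ᵍ G ^ᵍ 2
    ≡⟨ *ᵍ-assoc (A *ᵍ C *ᵍ P) _ _ ⟩
  A *ᵍ C *ᵍ P *ᵍ ((B *ᵍ D *ᵍ H) ^ᵍ 2 *ᵍ G ^ᵍ 2)
    ≡⟨ cong (A *ᵍ C *ᵍ P *ᵍ_) (^ᵍ-distribʳ-*ᵍ (B *ᵍ D *ᵍ H) G 2) ⟨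
  A *ᵍ C *ᵍ P *ᵍ (B *ᵍ D *ᵍ H *ᵍ G) ^ᵍ 2
    ∎
  where
  open ≡-Reasoning
  A B C D P H G : ℤ[i]
  A = iᵍ ^ᵍ s₀
  B = iᵍ ^ᵍ s₁
  C = 1+iᵍ ^ᵍ t₀
  D = 1+iᵍ ^ᵍ t₁
  P = prodᵍ (map proj₁ ps)
  H = prodᵍ (map (λ pr → proj₁ pr ^ᵍ ⌊ proj₂ pr /2⌋) ps)
  G = prodᵍ qs

≡1⊎≡3⇒odd : ∀ {r} → (r ≡ 1) ⊎ (r ≡ 3) → r ≡ 1 + 2 * ⌊ r /2⌋
≡1⊎≡3⇒odd (inj₁ refl) = refl
≡1⊎≡3⇒odd (inj₂ refl) = refl

corollary6p1 : (b : ℤ[i]) (s₀ s₁ t₀ t₁ : ℕ) (ps : List (ℤ[i] × ℕ)) (qs : List ℤ[i]) →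
    b ≢ 0ᵍ → FourthPowerFree b →
    s₀ ≤ 1 → s₁ ≤ 1 → t₀ ≤ 1 → t₁ ≤ 1 →
    All (λ pr → IsPrime (proj₁ pr) × Primary (proj₁ pr) × ((proj₂ pr ≡ 1) ⊎ (proj₂ pr ≡ 3))) ps →
    All (λ q → IsPrime q × Primary q) qs →
    Unique (map proj₁ ps ++ qs) →
    b ≡ (iᵍ ^ᵍ (s₀ + 2 * s₁)) *ᵍ (1+iᵍ ^ᵍ (t₀ + 2 * t₁))
          *ᵍ prodᵍ (map (λ pr → proj₁ pr ^ᵍ proj₂ pr) ps)
          *ᵍ prodᵍ (map (λ q → q ^ᵍ 2) qs) →
    InSelmer b ((iᵍ ^ᵍ s₀) *ᵍ (1+iᵍ ^ᵍ t₀) *ᵍ prodᵍ (map proj₁ ps))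
corollary6p1 b s₀ s₁ t₀ t₁ ps qs _ _ _ _ _ _ ps-conditions _ _ b≡ =
  subst (λ b → InSelmer b d) (sym b≡d*m²) (InSelmer-square-multiple d m)
  where
  d m : ℤ[i]
  d = iᵍ ^ᵍ s₀ *ᵍ 1+iᵍ ^ᵍ t₀ *ᵍ prodᵍ (map proj₁ ps)
  m = iᵍ ^ᵍ s₁ *ᵍ 1+iᵍ ^ᵍ t₁ *ᵍ prodᵍ (map (λ pr → proj₁ pr ^ᵍ ⌊ proj₂ pr /2⌋) ps) *ᵍ prodᵍ qs

  b≡d*m² : b ≡ d *ᵍ m ^ᵍ 2
  b≡d*m² = trans b≡ (odd-part-*ᵍ-square s₀ s₁ t₀ t₁ ps qs
    (All.map (λ conditions → ≡1⊎≡3⇒odd (proj₂ (proj₂ conditions))) ps-conditions))
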